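{- For every $\delta\in\mathcal{L}(\Rightarrow)$: (1) $\delta^\dagger\in\mathcal{L}$; (2) for every model $\mathcal{M}$, world $w$ and information state $X$, $\mathcal{M},w,X\vDash \delta$ iff $\mathcal{M},w,X\vDash \delta^\dagger$, where $\Rightarrow$ is interpreted by the Kolodny--MacFarlane semantics.
   Context: $\mathcal{L}(\Rightarrow)$: $\varphi::= p\mid \neg\varphi\mid \varphi\wedge\varphi\mid \Box\varphi \mid \varphi\Rightarrow\varphi$; $\mathcal{L}$ is its $\Rightarrow$-free fragment; nonmodal = no $\Box$, no $\Rightarrow$. Models $\mathcal{M}=\langle W,V\rangle$, evaluation at $w$ relative to $X\subseteq W$: $p$ and Booleans as usual, $\mathcal{M},w,X\vDash\Box\varphi$ iff $\mathcal{M},v,X\vDash\varphi$ for all $v\in X$; $[\![\varphi]\!]^{\mathcal{M},X}=\{v\in X\mid \mathcal{M},v,X\vDash\varphi\}$. Kolodny--MacFarlane: $\mathcal{M},w,X\vDash \varphi\Rightarrow\psi$ iff $\mathcal{M},w,X'\vDash \Box\psi$ for all $X'\subseteq X$ with $X'\subseteq[\![\varphi]\!]^{\mathcal{M},X'}$ that are maximal (under $\subseteq$) among subsets of $X$ with this property. Translation $(\cdot)^*$: for $\lambda=\Theta\Rightarrow\Omega$ with $\Theta=\bigvee_{i\in I}\theta_i$, $\Omega=\bigvee_{j\in J}\omega_j$ in K45 disjunctive normal form, $\theta_i= \varphi_i\wedge \Box\psi_i \wedge \bigwedge_{n\in D_i} \Diamond\chi_n$, $\omega_j= \alpha_j\wedge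 \Box\beta_j \wedge \bigwedge_{m\in D_j} \Diamond\gamma_m$ (all of $\varphi_i,\psi_i,\chi_n,\alpha_j,\beta_j,\gamma_m$ nonmodal), define for $K\subseteq I$: $\mathtt{info}_K:= (\bigvee_{k\in K} \varphi_k )\wedge \bigwedge_{k\in K}\psi_k$; $\mathtt{good}_K:= \bigwedge_{k\in K}\bigwedge_{n \in D_k} \Diamond (\mathtt{info}_K \wedge\chi_n)$; $\mathtt{max}_K:= \mathtt{good}_K\wedge \bigwedge_{L\subseteq I}\big(\big(\Box(\mathtt{info}_K\rightarrow \mathtt{info}_L)\wedge \Diamond (\neg \mathtt{info}_K\wedge\mathtt{info}_L)\big)\rightarrow \neg\mathtt{good}_L \big)$; for $S\subseteq J$: $\mathtt{state}_S:= \bigwedge_{s\in S}\alpha_s\wedge \bigwedge_{s\in J\setminus S}\neg\alpha_s$; and $\lambda^*:= \bigwedge_{K\subseteq I} \Big(\mathtt{max}_K\rightarrow \Box \big(\mathtt{info}_K \rightarrow \bigwedge_{S\subseteq J} \big(\mathtt{state}_S\rightarrow \bigvee_{s\in S}\big(\Box (\mathtt{info}_K\rightarrow \beta_s)\wedge \bigwedge_{m \in D_s}\Diamond(\mathtt{info}_K \wedge \gamma_m) \big) \big)\big) \Big)$. Translation $(\cdot)^\dagger$: $p^\dagger = p$, $(\neg\varphi)^\dagger = \neg \varphi^\dagger$, $(\varphi\wedge\psi)^\dagger = \varphi^\dagger\wedge\psi^\dagger$, $(\Box\varphi)^\dagger = \Box \varphi^\dagger$, $(\varphi \Rightarrow \psi)^\dagger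 =\big((\varphi^\dagger)^{NF}\Rightarrow(\psi^\dagger)^{NF}\big)^*$, where $\chi^{NF}$ is the K45 disjunctive normal form of $\chi$. -}

module Defs where

open import Data.Nat using (ℕ)
open import Data.Bool using (Bool; true; false; not)
open import Data.List using (List; []; _∷_; map; foldr; concatMap; _++_)
open import Data.Product using (_×_; _,_; proj₁; proj₂)
open import Data.Unit using (⊤)
open import Data.Empty using (⊥)
open import Relation.Binary.PropositionalEquality using (_≡_)
open import Relation.Nullary using (¬_)

infixr 4 _⇒_
infixr 5 _⊃_
infixr 6 _⋎_
infixr 7 _&_
infix 8 ~_ □_ ◇_

data Fm : Set where
  at  : ℕ → Fm
  ~_  : Fm → Fm
  _&_ : Fm → Fm → Fm
  □_  : Fm → Fm
  _⇒_ : Fm → Fm → Fm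

⊥' : Fm
⊥' = at 0 & ~ at 0

⊤' : Fm
⊤' = ~ ⊥'

_⋎_ : Fm → Fm → Fm
φ ⋎ ψ = ~ (~ φ & ~ ψ)

_⊃_ : Fm → Fm → Fm
φ ⊃ ψ = ~ (φ & ~ ψ)

◇_ : Fm → Fm
◇ φ = ~ □ ~ φ

⋀ : List Fm → Fm
⋀ = foldr _&_ ⊤'

⋁ : List Fm → Fm
⋁ = foldr _⋎_ ⊥'

IsL : Fm → Set
IsL (at n)  = ⊤
IsL (~ φ)   = IsL φ
IsL (φ & ψ) = IsL φ × IsL ψ
IsL (□ φ)   = IsL φ
IsL (φ ⇒ ψ) = ⊥

record Model : Set₁ where
  field
    W : Set
    V : ℕ → W → Bool
open Model public

Subset : Set → Set
Subset W = W → Bool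

_∈_ : {W : Set} → W → Subset W → Set
v ∈ X = X v ≡ true

_⊆_ : {W : Set} → Subset W → Subset W → Set
X ⊆ Y = ∀ v → v ∈ X → v ∈ Y

mutual
  Sat : (M : Model) → Fm → W M → Subset (W M) → Set
  Sat M (at n)  w X = V M n w ≡ true
  Sat M (~ φ)   w X = ¬ Sat M φ w X
  Sat M (φ & ψ) w X = Sat M φ w X × Sat M ψ w X
  Sat M (□ φ)   w X = ∀ v → v ∈ X → Sat M φ v X
  Sat M (φ ⇒ ψ) w X =
    -- i.e. M , w , X' ⊨ □ψ for every such maximal X'
    (X' : Subset (W M)) → KMMax M φ X X' → ∀ v → v ∈ X' → Sat M ψ v X'

  Supports : (M : Model) → Fm → Subset (W M) → Set
  Supports M φ Y = ∀ v → v ∈ Y → Sat M φ v Y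

  KMMax : (M : Model) → Fm → Subset (W M) → Subset (W M) → Set
  KMMax M φ X X' =
    (X' ⊆ X) × Supports M φ X' ×
    ((Y : Subset (W M)) → X' ⊆ Y → Y ⊆ X → Supports M φ Y → Y ⊆ X')

-- K45 disjunctive normal forms.
-- A disjunct  φ ∧ □ψ ∧ ⋀_{n} ◇χ_n  with φ, ψ, χ_n nonmodal.

record Disj : Set where
  constructor ⟨_,_,_⟩
  field
    nm   : Fm
    bx   : Fm
    dias : List Fm
open Disj public

DNF : Set
DNF = List Disj

disjFm : Disj → Fm
disjFm d = nm d & □ bx d & ⋀ (map ◇_ (dias d))

dnfFm : DNF → Fm
dnfFm D = ⋁ (map disjFm D)

splits : {A : Set} → List A → List (List A × List A)
splits []       = ([] , []) ∷ []
splits (x ∷ xs) =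
  concatMap (λ p → (x ∷ proj₁ p , proj₂ p) ∷ (proj₁ p , x ∷ proj₂ p) ∷ [])
            (splits xs)

subs : {A : Set} → List A → List (List A)
subs xs = map proj₁ (splits xs)

_⊗_ : Disj → Disj → Disj
d ⊗ e = ⟨ nm d & nm e , bx d & bx e , dias d ++ dias e ⟩

conjDNF : DNF → DNF → DNF
conjDNF D E = concatMap (λ d → map (d ⊗_) E) D

-- □ of a DNF:  □ ⋁_i (φ_i ∧ μ_i)  ≡  ⋁_{T ⊆ I} (⋀_{i∈T} μ_i ∧ □ ⋁_{i∈T} φ_i)
boxDisj : List Disj → Disj
boxDisj T = ⟨ ⊤' , ⋁ (map nm T) & ⋀ (map bx T) , concatMap dias T ⟩

boxDNF : DNF → DNF
boxDNF D = map boxDisj (subs D)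

-- ◇ of a DNF:  ◇ ⋁_i (φ_i ∧ μ_i)  ≡  ⋁_i (μ_i ∧ ◇ φ_i)
diaDNF : DNF → DNF
diaDNF D = map (λ d → ⟨ ⊤' , bx d , nm d ∷ dias d ⟩) D

-- nf true φ is the DNF of φ, nf false φ the DNF of ¬φ.
-- (The ⇒ clause is never used on ⇒-free inputs; it is a junk value.)
nf : Bool → Fm → DNF
nf true  (at n)  = ⟨ at n , ⊤' , [] ⟩ ∷ []
nf false (at n)  = ⟨ ~ at n , ⊤' , [] ⟩ ∷ []
nf b     (~ φ)   = nf (not b) φ
nf true  (φ & ψ) = conjDNF (nf true φ) (nf true ψ)
nf false (φ & ψ) = nf false φ ++ nf false ψ
nf true  (□ φ)   = boxDNF (nf true φ)
nf false (□ φ)   = diaDNF (nf false φ)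
nf b     (φ ⇒ ψ) = []

NF : Fm → DNF
NF = nf true

info : List Disj → Fm
info K = ⋁ (map nm K) & ⋀ (map bx K)

good : List Disj → Fm
good K = ⋀ (concatMap (λ k → map (λ χ → ◇ (info K & χ)) (dias k)) K)

maxK : DNF → List Disj → Fm
maxK Θ K =
  good K &
  ⋀ (map (λ L → (□ (info K ⊃ info L) & ◇ (~ info K & info L)) ⊃ ~ good L)
         (subs Θ))

state : List Disj × List Disj → Fm
state ST = ⋀ (map nm (proj₁ ST)) & ⋀ (map (λ s → ~ nm s) (proj₂ ST))

star : DNF → DNF → Fm
star Θ Ω =
  ⋀ (map (λ K →
      maxK Θ K ⊃
      □ (info K ⊃
          ⋀ (map (λ ST →
                state ST ⊃
                ⋁ (map (λ s → □ (info K ⊃ bx s) &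
                              ⋀ (map (λ γ → ◇ (info K & γ)) (dias s)))
                       (proj₁ ST)))
                 (splits Ω))))
     (subs Θ))

_† : Fm → Fm
at n †    = at n
(~ φ) †   = ~ (φ †)
(φ & ψ) † = (φ †) & (ψ †)
(□ φ) †   = □ (φ †)
(φ ⇒ ψ) † = star (NF (φ †)) (NF (ψ †))

-- The only new formulas are the (Θ ⇒ Ω)^*, built with
--     Boolean connectives, □ and ◇ from the components of the normal forms
--     Θ, Ω, and these components are nonmodal (nf-NM); see †-⇒free.
-- (2) Classically, δ and δ† agree at every world and state (†-correct), by
--     induction on δ.  Its KM clause says that ψ holds
--     throughout every maximal substate of X supporting φ (KMConditional);
--     φ and ψ may be replaced by the normal forms Θ, Ω of φ†, ψ† (nf-correct).
--     The heart of the argument: the maximal substates of X supporting Θ are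
--     exactly the restrictions X ↾ K of X to the info_K-worlds, for the K ⊆ Θ
--     satisfying max_K (maximal⇒MaxType, MaxType⇒maximal); from a maximal X′
--     one recovers K as the disjuncts of Θ whose modal part holds in X′
--     (fitting).  The conjuncts of (Θ ⇒ Ω)^* say exactly "Ω holds throughout
--     X ↾ K whenever max_K" (sat-star), which gives star-correct.

module Submission where

open import Defs
open import Level using (0ℓ)
open import Axiom.ExcludedMiddle using (ExcludedMiddle)
open import Axiom.DoubleNegationElimination using (em⇒dne)
open import Data.Bool using (Bool; true; false; _∧_)
open import Data.Product using (_×_; _,_; proj₁; proj₂; ∃)
open import Data.Sum using (_⊎_; inj₁; inj₂)
open import Data.Unit using (⊤; tt)
open import Data.Empty using (⊥; ⊥-elim)
open import Data.List using (List; []; _∷_; map; concatMap; filter; _++_)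
open import Data.List.Properties using (map-concatMap)
open import Data.List.Relation.Unary.Any using (here; there)
open import Data.List.Membership.Propositional using (find; lose) renaming (_∈_ to _∈L_)
open import Data.List.Membership.Propositional.Properties
  using (∈-map⁺; ∈-map⁻; ∈-concatMap⁺; ∈-concatMap⁻; ∈-filter⁺; ∈-filter⁻; ∈-++⁺ˡ; ∈-++⁺ʳ; ∈-++⁻)
open import Data.List.Relation.Binary.Subset.Propositional using () renaming (_⊆_ to _⊑_)
open import Relation.Nullary using (¬_; yes; no; ¬?)
open import Relation.Nullary.Decidable using (isYes)
open import Relation.Unary using (Decidable)
open import Relation.Binary.PropositionalEquality using (_≡_; refl; sym; cong; subst)
open import Function.Bundles using (_⇔_; mk⇔; Equivalence)
open Equivalence using (to; from)
open import Function.Construct.Symmetry using (⇔-sym)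
open import Function.Construct.Identity using (⇔-id)
open import Function.Construct.Composition using (_⇔-∘_)

module _ {A : Set} where

  extend : A → List A × List A → List (List A × List A)
  extend x p = (x ∷ proj₁ p , proj₂ p) ∷ (proj₁ p , x ∷ proj₂ p) ∷ []

  splits-step : ∀ x xs {pr} → pr ∈L splits (x ∷ xs) →
    ∃ λ p → p ∈L splits xs × (pr ≡ (x ∷ proj₁ p , proj₂ p) ⊎ pr ≡ (proj₁ p , x ∷ proj₂ p))
  splits-step x xs m with find (∈-concatMap⁻ (extend x) {xs = splits xs} m)
  ... | p , p∈ , here eq          = p , p∈ , inj₁ eq
  ... | p , p∈ , there (here eq)  = p , p∈ , inj₂ eq

  splits-⊑₁ : ∀ xs {pr} → pr ∈L splits xs → proj₁ pr ⊑ xs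
  splits-⊑₁ [] (here refl) ()
  splits-⊑₁ (x ∷ xs) m y∈ with splits-step x xs m
  ... | p , p∈ , inj₁ refl with y∈
  ...   | here eq  = here eq
  ...   | there y∈′ = there (splits-⊑₁ xs p∈ y∈′)
  splits-⊑₁ (x ∷ xs) m y∈ | p , p∈ , inj₂ refl = there (splits-⊑₁ xs p∈ y∈)

  splits-⊑₂ : ∀ xs {pr} → pr ∈L splits xs → proj₂ pr ⊑ xs
  splits-⊑₂ [] (here refl) ()
  splits-⊑₂ (x ∷ xs) m y∈ with splits-step x xs m
  ... | p , p∈ , inj₁ refl = there (splits-⊑₂ xs p∈ y∈)
  ... | p , p∈ , inj₂ refl with y∈
  ...   | here eq  = here eq
  ...   | there y∈′ = there (splits-⊑₂ xs p∈ y∈′)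

  splits-cover : ∀ xs {pr} → pr ∈L splits xs → ∀ {y} → y ∈L xs → y ∈L proj₁ pr ⊎ y ∈L proj₂ pr
  splits-cover (x ∷ xs) m y∈ with splits-step x xs m | y∈
  ... | p , p∈ , inj₁ refl | here eq = inj₁ (here eq)
  ... | p , p∈ , inj₂ refl | here eq = inj₂ (here eq)
  ... | p , p∈ , inj₁ refl | there y∈′ with splits-cover xs p∈ y∈′
  ...   | inj₁ l = inj₁ (there l)
  ...   | inj₂ r = inj₂ r
  splits-cover (x ∷ xs) m y∈ | p , p∈ , inj₂ refl | there y∈′ with splits-cover xs p∈ y∈′
  ...   | inj₁ l = inj₁ l
  ...   | inj₂ r = inj₂ (there r)

  partition∈splits : {P : A → Set} (P? : Decidable P) (xs : List A) →
    (filter P? xs , filter (λ x → ¬? (P? x)) xs) ∈L splits xs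
  partition∈splits P? [] = here refl
  partition∈splits P? (x ∷ xs) with P? x
  ... | yes _ = ∈-concatMap⁺ (extend x) (lose (partition∈splits P? xs) (here refl))
  ... | no _  = ∈-concatMap⁺ (extend x) (lose (partition∈splits P? xs) (there (here refl)))

  subs-⊑ : ∀ xs {ys} → ys ∈L subs xs → ys ⊑ xs
  subs-⊑ xs m with ∈-map⁻ proj₁ m
  ... | pr , pr∈ , refl = splits-⊑₁ xs pr∈

  filter∈subs : {P : A → Set} (P? : Decidable P) (xs : List A) → filter P? xs ∈L subs xs
  filter∈subs P? xs = ∈-map⁺ proj₁ (partition∈splits P? xs)

  -- Quantifying over all splittings (T , F) of xs such that P holds on T and
  -- fails on F amounts to quantifying over the elements of xs satisfying P:
  -- the splitting along P is the decisive instance.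
  splits-cases : {P Q : A → Set} (P? : Decidable P) (xs : List A) →
    (∀ pr → pr ∈L splits xs → (∀ x → x ∈L proj₁ pr → P x) → (∀ x → x ∈L proj₂ pr → ¬ P x) →
       ∃ λ x → x ∈L proj₁ pr × Q x)
    ⇔ (∃ λ x → x ∈L xs × P x × Q x)
  splits-cases {P} {Q} P? xs = mk⇔ along-P by-cover
    where
    Cases : Set
    Cases = ∀ pr → pr ∈L splits xs → (∀ x → x ∈L proj₁ pr → P x) →
              (∀ x → x ∈L proj₂ pr → ¬ P x) → ∃ λ x → x ∈L proj₁ pr × Q x
    along-P : Cases → ∃ λ x → x ∈L xs × P x × Q x
    along-P H =
      let x , x∈P , q = H _ (partition∈splits P? xs)
                          (λ _ m → proj₂ (∈-filter⁻ P? {xs = xs} m))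
                          (λ _ m → proj₂ (∈-filter⁻ (λ x → ¬? (P? x)) {xs = xs} m))
          x∈ , p = ∈-filter⁻ P? {xs = xs} x∈P
      in x , x∈ , p , q
    by-cover : (∃ λ x → x ∈L xs × P x × Q x) → Cases
    by-cover (x , x∈ , p , q) pr pr∈ onT onF = side (splits-cover xs pr∈ x∈)
      where
      side : x ∈L proj₁ pr ⊎ x ∈L proj₂ pr → ∃ λ y → y ∈L proj₁ pr × Q y
      side (inj₁ inT) = x , inT , q
      side (inj₂ inF) = ⊥-elim (onF x inF p)

∀-map : {A B : Set} {P : B → Set} (f : A → B) (xs : List A) →
  (∀ x → x ∈L xs → P (f x)) → ∀ y → y ∈L map f xs → P y
∀-map {P = P} f xs h y y∈ = let x , x∈ , eq = ∈-map⁻ f y∈ in subst P (sym eq) (h x x∈)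

record BooleanClosed (P : Fm → Set) : Set where
  field
    atom : ∀ n → P (at n)
    neg  : ∀ {φ} → P φ → P (~ φ)
    conj : ∀ {φ ψ} → P φ → P ψ → P (φ & ψ)

module _ {P : Fm → Set} (closed : BooleanClosed P) where
  open BooleanClosed closed

  ⋀-closed : ∀ L → (∀ φ → φ ∈L L → P φ) → P (⋀ L)
  ⋀-closed []      _ = neg (conj (atom 0) (neg (atom 0)))
  ⋀-closed (φ ∷ L) h = conj (h φ (here refl)) (⋀-closed L (λ ψ m → h ψ (there m)))

  ⋁-closed : ∀ L → (∀ φ → φ ∈L L → P φ) → P (⋁ L)
  ⋁-closed []      _ = conj (atom 0) (neg (atom 0))
  ⋁-closed (φ ∷ L) h =
    neg (conj (neg (h φ (here refl))) (neg (⋁-closed L (λ ψ m → h ψ (there m)))))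

  ⋀-map-closed : {A : Set} (f : A → Fm) (xs : List A) → (∀ x → x ∈L xs → P (f x)) → P (⋀ (map f xs))
  ⋀-map-closed f xs h = ⋀-closed (map f xs) (∀-map f xs h)

  ⋁-map-closed : {A : Set} (f : A → Fm) (xs : List A) → (∀ x → x ∈L xs → P (f x)) → P (⋁ (map f xs))
  ⋁-map-closed f xs h = ⋁-closed (map f xs) (∀-map f xs h)

NM : Fm → Set
NM (at n)  = ⊤
NM (~ φ)   = NM φ
NM (φ & ψ) = NM φ × NM ψ
NM (□ φ)   = ⊥
NM (φ ⇒ ψ) = ⊥

NM-closed : BooleanClosed NM
NM-closed = record { atom = λ _ → tt ; neg = λ h → h ; conj = _,_ }

IsL-closed : BooleanClosed IsL
IsL-closed = record { atom = λ _ → tt ; neg = λ h → h ; conj = _,_ }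

NM⇒IsL : ∀ φ → NM φ → IsL φ
NM⇒IsL (at n)  _        = tt
NM⇒IsL (~ φ)   h        = NM⇒IsL φ h
NM⇒IsL (φ & ψ) (hφ , hψ) = NM⇒IsL φ hφ , NM⇒IsL ψ hψ

NMDisj : Disj → Set
NMDisj d = NM (nm d) × NM (bx d) × (∀ χ → χ ∈L dias d → NM χ)

NMDNF : DNF → Set
NMDNF D = ∀ d → d ∈L D → NMDisj d

NMDNF-⊑ : ∀ {D E} → D ⊑ E → NMDNF E → NMDNF D
NMDNF-⊑ D⊑E hE d d∈ = hE d (D⊑E d∈)

info-NM : ∀ K → NMDNF K → NM (info K)
info-NM K hK = ⋁-map-closed NM-closed nm K (λ k k∈ → proj₁ (hK k k∈))
             , ⋀-map-closed NM-closed bx K (λ k k∈ → proj₁ (proj₂ (hK k k∈)))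

dias-NM : ∀ K → NMDNF K → ∀ χ → χ ∈L concatMap dias K → NM χ
dias-NM K hK χ χ∈ with find (∈-concatMap⁻ dias {xs = K} χ∈)
... | k , k∈ , χ∈k = proj₂ (proj₂ (hK k k∈)) χ χ∈k

⊤-NM : NM ⊤'
⊤-NM = tt , tt

conjDNF-NM : ∀ D E → NMDNF D → NMDNF E → NMDNF (conjDNF D E)
conjDNF-NM D E hD hE d d∈ with find (∈-concatMap⁻ (λ d′ → map (d′ ⊗_) E) {xs = D} d∈)
... | d′ , d′∈ , m with ∈-map⁻ (d′ ⊗_) m
... | e , e∈ , refl = (nm₁ , nm₂) , (bx₁ , bx₂) , dias⊗-NM
  where
  nm₁ = proj₁ (hD d′ d′∈) ; bx₁ = proj₁ (proj₂ (hD d′ d′∈))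
  nm₂ = proj₁ (hE e e∈)   ; bx₂ = proj₁ (proj₂ (hE e e∈))
  dias⊗-NM : ∀ χ → χ ∈L dias d′ ++ dias e → NM χ
  dias⊗-NM χ χ∈ with ∈-++⁻ (dias d′) χ∈
  ... | inj₁ l = proj₂ (proj₂ (hD d′ d′∈)) χ l
  ... | inj₂ r = proj₂ (proj₂ (hE e e∈)) χ r

++-NM : ∀ D E → NMDNF D → NMDNF E → NMDNF (D ++ E)
++-NM D E hD hE d d∈ with ∈-++⁻ D d∈
... | inj₁ l = hD d l
... | inj₂ r = hE d r

boxDNF-NM : ∀ D → NMDNF D → NMDNF (boxDNF D)
boxDNF-NM D hD d d∈ with ∈-map⁻ boxDisj d∈
... | T , T∈ , refl = ⊤-NM , info-NM T hT , dias-NM T hT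
  where
  hT : NMDNF T
  hT = NMDNF-⊑ (subs-⊑ D T∈) hD

diaDNF-NM : ∀ D → NMDNF D → NMDNF (diaDNF D)
diaDNF-NM D hD d d∈ with ∈-map⁻ (λ e → ⟨ ⊤' , bx e , nm e ∷ dias e ⟩) d∈
... | e , e∈ , refl = ⊤-NM , proj₁ (proj₂ (hD e e∈)) , dias◇-NM
  where
  dias◇-NM : ∀ χ → χ ∈L nm e ∷ dias e → NM χ
  dias◇-NM χ (here refl) = proj₁ (hD e e∈)
  dias◇-NM χ (there χ∈)  = proj₂ (proj₂ (hD e e∈)) χ χ∈

nf-NM : ∀ b φ → NMDNF (nf b φ)
nf-NM true  (at n)  _ (here refl) = tt , ⊤-NM , λ _ ()
nf-NM false (at n)  _ (here refl) = tt , ⊤-NM , λ _ ()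
nf-NM true  (~ φ)   = nf-NM false φ
nf-NM false (~ φ)   = nf-NM true φ
nf-NM true  (φ & ψ) = conjDNF-NM (nf true φ) (nf true ψ) (nf-NM true φ) (nf-NM true ψ)
nf-NM false (φ & ψ) = ++-NM (nf false φ) (nf false ψ) (nf-NM false φ) (nf-NM false ψ)
nf-NM true  (□ φ)   = boxDNF-NM (nf true φ) (nf-NM true φ)
nf-NM false (□ φ)   = diaDNF-NM (nf false φ) (nf-NM false φ)
nf-NM true  (φ ⇒ ψ) _ ()
nf-NM false (φ ⇒ ψ) _ ()

strictlyBelow : List Disj → List Disj → Fm
strictlyBelow K L = □ (info K ⊃ info L) & ◇ (~ info K & info L)

witness : List Disj → Disj → Fm
witness K s = □ (info K ⊃ bx s) & ⋀ (map (λ γ → ◇ (info K & γ)) (dias s))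

consequent : DNF → List Disj → Fm
consequent Ω K =
  □ (info K ⊃ ⋀ (map (λ ST → state ST ⊃ ⋁ (map (witness K) (proj₁ ST))) (splits Ω)))

info-⇒free : ∀ K → NMDNF K → IsL (info K)
info-⇒free K hK = NM⇒IsL (info K) (info-NM K hK)

good-≡ : ∀ K → good K ≡ ⋀ (map (λ χ → ◇ (info K & χ)) (concatMap dias K))
good-≡ K = cong ⋀ (sym (map-concatMap (λ χ → ◇ (info K & χ)) dias K))

good-⇒free : ∀ K → NMDNF K → IsL (good K)
good-⇒free K hK = subst IsL (sym (good-≡ K))
  (⋀-map-closed IsL-closed (λ χ → ◇ (info K & χ)) (concatMap dias K)
    λ χ χ∈ → info-⇒free K hK , NM⇒IsL χ (dias-NM K hK χ χ∈))

star-⇒free : ∀ Θ Ω → NMDNF Θ → NMDNF Ω → IsL (star Θ Ω)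
star-⇒free Θ Ω hΘ hΩ =
  ⋀-map-closed IsL-closed (λ K → maxK Θ K ⊃ consequent Ω K) (subs Θ) clause
  where
  sub-NM : ∀ {K} → K ∈L subs Θ → NMDNF K
  sub-NM K∈ = NMDNF-⊑ (subs-⊑ Θ K∈) hΘ

  maxK-⇒free : ∀ K → NMDNF K → IsL (maxK Θ K)
  maxK-⇒free K hK = good-⇒free K hK ,
    ⋀-map-closed IsL-closed (λ L → strictlyBelow K L ⊃ ~ good L) (subs Θ) λ L L∈ →
      let iK = info-⇒free K hK ; iL = info-⇒free L (sub-NM L∈)
      in ((iK , iL) , (iK , iL)) , good-⇒free L (sub-NM L∈)

  witness-⇒free : ∀ K → NMDNF K → ∀ s → s ∈L Ω → IsL (witness K s)
  witness-⇒free K hK s s∈ =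
    (info-⇒free K hK , NM⇒IsL (bx s) (proj₁ (proj₂ (hΩ s s∈)))) ,
    ⋀-map-closed IsL-closed (λ γ → ◇ (info K & γ)) (dias s)
      (λ γ γ∈ → info-⇒free K hK , NM⇒IsL γ (proj₂ (proj₂ (hΩ s s∈)) γ γ∈))

  state-⇒free : ∀ ST → ST ∈L splits Ω → IsL (state ST)
  state-⇒free ST ST∈ =
    ⋀-map-closed IsL-closed nm (proj₁ ST)
      (λ s s∈ → NM⇒IsL (nm s) (proj₁ (hΩ s (splits-⊑₁ Ω ST∈ s∈)))) ,
    ⋀-map-closed IsL-closed (λ s → ~ nm s) (proj₂ ST)
      (λ s s∈ → NM⇒IsL (nm s) (proj₁ (hΩ s (splits-⊑₂ Ω ST∈ s∈))))

  clause : ∀ K → K ∈L subs Θ → IsL (maxK Θ K ⊃ consequent Ω K)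
  clause K K∈ = maxK-⇒free K hK , info-⇒free K hK ,
    ⋀-map-closed IsL-closed (λ ST → state ST ⊃ ⋁ (map (witness K) (proj₁ ST))) (splits Ω) λ ST ST∈ →
      state-⇒free ST ST∈ ,
      ⋁-map-closed IsL-closed (witness K) (proj₁ ST) (λ s s∈ → witness-⇒free K hK s (splits-⊑₁ Ω ST∈ s∈))
    where
    hK = sub-NM K∈

†-⇒free : ∀ δ → IsL (δ †)
†-⇒free (at n)  = tt
†-⇒free (~ δ)   = †-⇒free δ
†-⇒free (δ & ε) = †-⇒free δ , †-⇒free ε
†-⇒free (□ δ)   = †-⇒free δ
†-⇒free (φ ⇒ ψ) = star-⇒free (NF (φ †)) (NF (ψ †)) (nf-NM true (φ †)) (nf-NM true (ψ †))

module _ {W : Set} where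

  Supported : (W → Subset W → Set) → Subset W → Set
  Supported P Y = ∀ v → v ∈ Y → P v Y

  MaxSupported : (W → Subset W → Set) → Subset W → Subset W → Set
  MaxSupported P X X′ =
    X′ ⊆ X × Supported P X′ × (∀ Y → X′ ⊆ Y → Y ⊆ X → Supported P Y → Y ⊆ X′)

  KMConditional : (P R : W → Subset W → Set) → Subset W → Set
  KMConditional P R X = ∀ X′ → MaxSupported P X X′ → ∀ v → v ∈ X′ → R v X′

  KMConditional-cong : ∀ {P P′ R R′ : W → Subset W → Set} {X} →
    (∀ v Y → P v Y ⇔ P′ v Y) → (∀ v Y → R v Y ⇔ R′ v Y) →
    KMConditional P R X ⇔ KMConditional P′ R′ X
  KMConditional-cong P⇔P′ R⇔R′ = mk⇔
    (transfer P⇔P′ R⇔R′)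
    (transfer (λ v Y → ⇔-sym (P⇔P′ v Y)) (λ v Y → ⇔-sym (R⇔R′ v Y)))
    where
    supported : ∀ {A B : W → Subset W → Set} → (∀ v Y → A v Y → B v Y) →
      ∀ {Y} → Supported A Y → Supported B Y
    supported A→B sup v v∈ = A→B v _ (sup v v∈)
    transfer : ∀ {A B C D : W → Subset W → Set} {X} →
      (∀ v Y → A v Y ⇔ B v Y) → (∀ v Y → C v Y ⇔ D v Y) → KMConditional A C X → KMConditional B D X
    transfer {A} {X = X} A⇔B C⇔D k X′ (X′⊆X , sup , maximal) v v∈ =
      to (C⇔D v X′) (k X′ (X′⊆X , supported (λ u Z → from (A⇔B u Z)) sup , maximal′) v v∈)
      where
      maximal′ : ∀ Y → X′ ⊆ Y → Y ⊆ X → Supported A Y → Y ⊆ X′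
      maximal′ Y X′⊆Y Y⊆X supY = maximal Y X′⊆Y Y⊆X (supported (λ u Z → to (A⇔B u Z)) supY)

-- The semantics interprets ~ by Agda negation, so the Boolean reasoning
-- behind normal forms needs excluded middle.
module Classical (em : ExcludedMiddle 0ℓ) (M : Model) where

  State : Set
  State = Subset (W M)

  sat : Fm → W M → State → Set
  sat = Sat M

  dne : {P : Set} → ¬ ¬ P → P
  dne = em⇒dne em

  sat-⊤ : ∀ {w X} → sat ⊤' w X
  sat-⊤ (p , ¬p) = ¬p p

  sat-⊃ : ∀ φ ψ {w X} → sat (φ ⊃ ψ) w X ⇔ (sat φ w X → sat ψ w X)
  sat-⊃ φ ψ = mk⇔ (λ s a → dne λ ¬b → s (a , ¬b)) (λ f (a , ¬b) → ¬b (f a))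

  sat-◇ : ∀ φ {w X} → sat (◇ φ) w X ⇔ (∃ λ v → v ∈ X × sat φ v X)
  sat-◇ φ = mk⇔ (λ s → dne λ none → s λ v v∈ p → none (v , v∈ , p))
                (λ (v , v∈ , p) all¬ → all¬ v v∈ p)

  sat-⋀ : ∀ L {w X} → sat (⋀ L) w X ⇔ (∀ φ → φ ∈L L → sat φ w X)
  sat-⋀ L = mk⇔ (elim L) (intro L)
    where
    elim : ∀ L {w X} → sat (⋀ L) w X → ∀ φ → φ ∈L L → sat φ w X
    elim (ψ ∷ L) (s , _)  φ (here refl) = s
    elim (ψ ∷ L) (_ , ss) φ (there φ∈)  = elim L ss φ φ∈
    intro : ∀ L {w X} → (∀ φ → φ ∈L L → sat φ w X) → sat (⋀ L) w X
    intro []      {w} {X} _ = sat-⊤ {w} {X}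
    intro (ψ ∷ L) h = h ψ (here refl) , intro L λ φ φ∈ → h φ (there φ∈)

  sat-⋁ : ∀ L {w X} → sat (⋁ L) w X ⇔ (∃ λ φ → φ ∈L L × sat φ w X)
  sat-⋁ L = mk⇔ (elim L) (intro L)
    where
    elim : ∀ L {w X} → sat (⋁ L) w X → ∃ λ φ → φ ∈L L × sat φ w X
    elim []      (p , ¬p) = ⊥-elim (¬p p)
    elim (ψ ∷ L) {w} {X} s with em {sat ψ w X}
    ... | yes p = ψ , here refl , p
    ... | no ¬p = let φ , φ∈ , q = elim L (dne λ ¬rest → s (¬p , ¬rest)) in φ , there φ∈ , q
    intro : ∀ L {w X} → (∃ λ φ → φ ∈L L × sat φ w X) → sat (⋁ L) w X
    intro (ψ ∷ L) (φ , here refl , q) (¬ψ , _)    = ¬ψ q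
    intro (ψ ∷ L) (φ , there φ∈ , q) (_ , ¬rest) = ¬rest (intro L (φ , φ∈ , q))

  sat-⋀-map : {A : Set} (f : A → Fm) (xs : List A) {w : W M} {X : State} →
    sat (⋀ (map f xs)) w X ⇔ (∀ x → x ∈L xs → sat (f x) w X)
  sat-⋀-map f xs = mk⇔
    (λ s x x∈ → to (sat-⋀ (map f xs)) s (f x) (∈-map⁺ f x∈))
    (λ h → from (sat-⋀ (map f xs)) (∀-map f xs h))

  sat-⋁-map : {A : Set} (f : A → Fm) (xs : List A) {w : W M} {X : State} →
    sat (⋁ (map f xs)) w X ⇔ (∃ λ x → x ∈L xs × sat (f x) w X)
  sat-⋁-map f xs = mk⇔
    (λ s → let φ , φ∈ , q = to (sat-⋁ (map f xs)) s ; x , x∈ , eq = ∈-map⁻ f φ∈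
           in x , x∈ , subst (λ χ → sat χ _ _) eq q)
    (λ (x , x∈ , q) → from (sat-⋁ (map f xs)) (f x , ∈-map⁺ f x∈ , q))

  local : ∀ φ → NM φ → ∀ {w X Y} → sat φ w X → sat φ w Y
  local (at n)  _         s        = s
  local (~ φ)   h {w} {X} {Y} ¬s t = ¬s (local φ h {w} {Y} {X} t)
  local (φ & ψ) (hφ , hψ) (a , b)  = local φ hφ a , local ψ hψ b

  Witnessed : List Fm → State → Set
  Witnessed Χ Y = ∀ χ → χ ∈L Χ → ∃ λ v → v ∈ Y × sat χ v Y

  Fits : Disj → State → Set
  Fits d X = (∀ v → v ∈ X → sat (bx d) v X) × Witnessed (dias d) X

  SatD : Disj → W M → State → Set
  SatD d w X = sat (nm d) w X × Fits d X

  SatN : DNF → W M → State → Set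
  SatN D w X = ∃ λ d → d ∈L D × SatD d w X

  Witnessed-mono : ∀ Χ {Y Z} → (∀ χ → χ ∈L Χ → NM χ) → Y ⊆ Z → Witnessed Χ Y → Witnessed Χ Z
  Witnessed-mono Χ nmΧ Y⊆Z wit χ χ∈ =
    let v , v∈ , s = wit χ χ∈ in v , Y⊆Z v v∈ , local χ (nmΧ χ χ∈) s

  fitting : DNF → State → List Disj
  fitting D X = filter (λ d → em {Fits d X}) D

  fitting-⊑ : ∀ D X → fitting D X ⊑ D
  fitting-⊑ D X d∈ = proj₁ (∈-filter⁻ (λ d → em {Fits d X}) {xs = D} d∈)

  fitting-fits : ∀ D X {d} → d ∈L fitting D X → Fits d X
  fitting-fits D X d∈ = proj₂ (∈-filter⁻ (λ d → em {Fits d X}) {xs = D} d∈)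

  fitting-info : ∀ D {X v} → Supported (SatN D) X → v ∈ X → sat (info (fitting D X)) v X
  fitting-info D {X} {v} sup v∈ =
    let d , d∈ , nm-d , fits = sup v v∈
    in from (sat-⋁-map nm (fitting D X)) (d , ∈-filter⁺ (λ d → em {Fits d X}) d∈ fits , nm-d) ,
       from (sat-⋀-map bx (fitting D X)) λ k k∈ → proj₁ (fitting-fits D X k∈) v v∈

  fitting-witnessed : ∀ D X → Witnessed (concatMap dias (fitting D X)) X
  fitting-witnessed D X χ χ∈ =
    let k , k∈ , χ∈k = find (∈-concatMap⁻ dias {xs = fitting D X} χ∈)
    in proj₂ (fitting-fits D X k∈) χ χ∈k

  info-supported : ∀ D T {Y} → T ⊑ D → (∀ u → u ∈ Y → sat (info T) u Y) →
    Witnessed (concatMap dias T) Y → Supported (SatN D) Y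
  info-supported D T {Y} T⊑D infoT wit v v∈ =
    let t , t∈ , nm-t = to (sat-⋁-map nm T) (proj₁ (infoT v v∈))
    in t , T⊑D t∈ , nm-t , (λ u u∈ → to (sat-⋀-map bx T) (proj₂ (infoT u u∈)) t t∈) ,
       λ χ χ∈ → wit χ (∈-concatMap⁺ dias (lose t∈ χ∈))

  SatN-conj : ∀ D E {w X} → SatN (conjDNF D E) w X ⇔ (SatN D w X × SatN E w X)
  SatN-conj D E {w} {X} = mk⇔ split join
    where
    split : SatN (conjDNF D E) w X → SatN D w X × SatN E w X
    split (x , x∈ , nm-x , bxs , wit)
      with find (∈-concatMap⁻ (λ d → map (d ⊗_) E) {xs = D} x∈)
    ... | d , d∈ , m with ∈-map⁻ (d ⊗_) m
    ... | e , e∈ , refl =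
      (d , d∈ , proj₁ nm-x , (λ v v∈ → proj₁ (bxs v v∈)) , λ χ χ∈ → wit χ (∈-++⁺ˡ χ∈)) ,
      (e , e∈ , proj₂ nm-x , (λ v v∈ → proj₂ (bxs v v∈)) , λ χ χ∈ → wit χ (∈-++⁺ʳ (dias d) χ∈))
    join : SatN D w X × SatN E w X → SatN (conjDNF D E) w X
    join ((d , d∈ , nm-d , bx-d , wit-d) , (e , e∈ , nm-e , bx-e , wit-e)) =
      d ⊗ e , ∈-concatMap⁺ (λ d → map (d ⊗_) E) (lose d∈ (∈-map⁺ (d ⊗_) e∈)) ,
      (nm-d , nm-e) , (λ v v∈ → bx-d v v∈ , bx-e v v∈) , wit
      where
      wit : Witnessed (dias d ++ dias e) X
      wit χ χ∈ with ∈-++⁻ (dias d) χ∈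
      ... | inj₁ l = wit-d χ l
      ... | inj₂ r = wit-e χ r

  SatN-++ : ∀ D E {w X} → SatN (D ++ E) w X ⇔ (SatN D w X ⊎ SatN E w X)
  SatN-++ D E = mk⇔ split join
    where
    split : ∀ {w X} → SatN (D ++ E) w X → SatN D w X ⊎ SatN E w X
    split (d , d∈ , s) with ∈-++⁻ D d∈
    ... | inj₁ l = inj₁ (d , l , s)
    ... | inj₂ r = inj₂ (d , r , s)
    join : ∀ {w X} → SatN D w X ⊎ SatN E w X → SatN (D ++ E) w X
    join (inj₁ (d , d∈ , s)) = d , ∈-++⁺ˡ d∈ , s
    join (inj₂ (d , d∈ , s)) = d , ∈-++⁺ʳ D d∈ , s

  -- □ of a DNF: the disjunct of boxDNF D that holds is the one built from
  -- the disjuncts of D fitting the current state.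
  SatN-box : ∀ D {w X} → SatN (boxDNF D) w X ⇔ Supported (SatN D) X
  SatN-box D {w} {X} = mk⇔ split join
    where
    split : SatN (boxDNF D) w X → Supported (SatN D) X
    split (x , x∈ , _ , infoT , wit) with ∈-map⁻ boxDisj x∈
    ... | T , T∈ , refl = info-supported D T (subs-⊑ D T∈) infoT wit
    join : Supported (SatN D) X → SatN (boxDNF D) w X
    join sup = boxDisj (fitting D X) ,
      ∈-map⁺ boxDisj (filter∈subs (λ d → em {Fits d X}) D) ,
      sat-⊤ {w} {X} , (λ v v∈ → fitting-info D sup v∈) , fitting-witnessed D X

  SatN-dia : ∀ D {w X} → SatN (diaDNF D) w X ⇔ (∃ λ v → v ∈ X × SatN D v X)
  SatN-dia D {w} {X} = mk⇔ split join
    where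
    diaDisj : Disj → Disj
    diaDisj d = ⟨ ⊤' , bx d , nm d ∷ dias d ⟩
    split : SatN (diaDNF D) w X → ∃ λ v → v ∈ X × SatN D v X
    split (x , x∈ , _ , bxs , wit) with ∈-map⁻ diaDisj x∈
    ... | d , d∈ , refl =
      let v , v∈ , nm-d = wit (nm d) (here refl)
      in v , v∈ , d , d∈ , nm-d , bxs , λ χ χ∈ → wit χ (there χ∈)
    join : (∃ λ v → v ∈ X × SatN D v X) → SatN (diaDNF D) w X
    join (v , v∈ , d , d∈ , nm-d , bxs , wit) =
      diaDisj d , ∈-map⁺ diaDisj d∈ , sat-⊤ {w} {X} , bxs , wit′
      where
      wit′ : Witnessed (nm d ∷ dias d) X
      wit′ χ (here refl) = v , v∈ , nm-d
      wit′ χ (there χ∈)  = wit χ χ∈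

  mutual
    nf-correct : ∀ φ → IsL φ → ∀ {w X} → sat φ w X ⇔ SatN (nf true φ) w X
    nf-correct (at n)  _ {w} {X} =
      mk⇔ (λ s → _ , here refl , s , (λ v _ → sat-⊤ {v} {X}) , λ _ ())
          (λ { (_ , here refl , s , _) → s })
    nf-correct (~ φ)   h = nf-correct¬ φ h
    nf-correct (φ & ψ) (hφ , hψ) = mk⇔
      (λ (a , b) → from (SatN-conj (nf true φ) (nf true ψ))
                          (to (nf-correct φ hφ) a , to (nf-correct ψ hψ) b))
      (λ s → let a , b = to (SatN-conj (nf true φ) (nf true ψ)) s
             in from (nf-correct φ hφ) a , from (nf-correct ψ hψ) b)
    nf-correct (□ φ)   h = mk⇔
      (λ s → from (SatN-box (nf true φ)) λ v v∈ → to (nf-correct φ h) (s v v∈))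
      (λ s v v∈ → from (nf-correct φ h) (to (SatN-box (nf true φ)) s v v∈))

    nf-correct¬ : ∀ φ → IsL φ → ∀ {w X} → (¬ sat φ w X) ⇔ SatN (nf false φ) w X
    nf-correct¬ (at n)  _ {w} {X} =
      mk⇔ (λ s → _ , here refl , s , (λ v _ → sat-⊤ {v} {X}) , λ _ ())
          (λ { (_ , here refl , s , _) → s })
    nf-correct¬ (~ φ)   h = mk⇔
      (λ ¬¬s → to (nf-correct φ h) (dne ¬¬s))
      (λ s ¬s → ¬s (from (nf-correct φ h) s))
    nf-correct¬ (φ & ψ) (hφ , hψ) {w} {X} = mk⇔
      (λ ¬ab → from (SatN-++ (nf false φ) (nf false ψ)) (de-morgan ¬ab))
      (λ s (a , b) → refute (to (SatN-++ (nf false φ) (nf false ψ)) s) a b)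
      where
      de-morgan : ¬ (sat φ w X × sat ψ w X) → SatN (nf false φ) w X ⊎ SatN (nf false ψ) w X
      de-morgan ¬ab with em {sat φ w X}
      ... | yes a = inj₂ (to (nf-correct¬ ψ hψ) λ b → ¬ab (a , b))
      ... | no ¬a = inj₁ (to (nf-correct¬ φ hφ) ¬a)
      refute : SatN (nf false φ) w X ⊎ SatN (nf false ψ) w X → sat φ w X → ¬ sat ψ w X
      refute (inj₁ s) a _ = from (nf-correct¬ φ hφ) s a
      refute (inj₂ s) _ b = from (nf-correct¬ ψ hψ) s b
    nf-correct¬ (□ φ)   h {w} {X} = mk⇔
      (λ ¬□ → from (SatN-dia (nf false φ))
                (dne λ none → ¬□ λ v v∈ → dne λ ¬s → none (v , v∈ , to (nf-correct¬ φ h) ¬s)))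
      (λ s □φ → let v , v∈ , s′ = to (SatN-dia (nf false φ)) s in from (nf-correct¬ φ h) s′ (□φ v v∈))

  infix 30 _↾_
  _↾_ : State → List Disj → State
  (X ↾ K) v = X v ∧ isYes (em {sat (info K) v X})

  ↾-intro : ∀ {X K v} → v ∈ X → sat (info K) v X → v ∈ X ↾ K
  ↾-intro {X} {K} {v} v∈ i with em {sat (info K) v X}
  ... | yes _ rewrite v∈ = refl
  ... | no ¬i = ⊥-elim (¬i i)

  ↾-elim : ∀ {X K v} → v ∈ X ↾ K → v ∈ X × sat (info K) v X
  ↾-elim {X} {K} {v} m with X v | em {sat (info K) v X}
  ... | true  | yes i = refl , i
  ↾-elim {X} {K} {v} () | true  | no _
  ↾-elim {X} {K} {v} () | false | _

  ↾-⊆ : ∀ X K → X ↾ K ⊆ X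
  ↾-⊆ X K v v∈ = proj₁ (↾-elim {X} {K} v∈)

  sat-□-info : ∀ K χ {w X} → sat (□ (info K ⊃ χ)) w X ⇔ (∀ v → v ∈ X ↾ K → sat χ v X)
  sat-□-info K χ {w} {X} = mk⇔
    (λ s v v∈ → let v∈X , i = ↾-elim {X} {K} v∈ in to (sat-⊃ (info K) χ) (s v v∈X) i)
    (λ h v v∈ → from (sat-⊃ (info K) χ) λ i → h v (↾-intro {X} {K} v∈ i))

  sat-◇-info : ∀ K χ {w X} → sat (◇ (info K & χ)) w X ⇔ (∃ λ v → v ∈ X ↾ K × sat χ v X)
  sat-◇-info K χ {w} {X} = mk⇔
    (λ s → let v , v∈ , i , c = to (sat-◇ (info K & χ) {w} {X}) s in v , ↾-intro {X} {K} v∈ i , c)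
    (λ (v , v∈ , c) → let v∈X , i = ↾-elim {X} {K} v∈
                      in from (sat-◇ (info K & χ) {w} {X}) (v , v∈X , i , c))

  Good : List Disj → State → Set
  Good K Y = Witnessed (concatMap dias K) Y

  sat-good : ∀ K → NMDNF K → ∀ {w X} → sat (good K) w X ⇔ Good K (X ↾ K)
  sat-good K hK {w} {X} = mk⇔
    (λ s χ χ∈ →
      let s′ = subst (λ φ → sat φ w X) (good-≡ K) s
          v , v∈ , c = to (sat-◇-info K χ {w}) (to (sat-⋀-map ◇info Χ) s′ χ χ∈)
      in v , v∈ , local χ (dias-NM K hK χ χ∈) c)
    (λ g → subst (λ φ → sat φ w X) (sym (good-≡ K)) (from (sat-⋀-map ◇info Χ) λ χ χ∈ →
      let v , v∈ , c = g χ χ∈ in from (sat-◇-info K χ {w}) (v , v∈ , local χ (dias-NM K hK χ χ∈) c)))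
    where
    ◇info : Fm → Fm
    ◇info χ = ◇ (info K & χ)
    Χ = concatMap dias K

  _⊂_ : State → State → Set
  Y ⊂ Z = Y ⊆ Z × ∃ λ v → v ∈ Z × ¬ v ∈ Y

  sat-strictlyBelow : ∀ K L {w X} → sat (strictlyBelow K L) w X ⇔ X ↾ K ⊂ X ↾ L
  sat-strictlyBelow K L {w} {X} = mk⇔
    (λ (below , beyond) →
      (λ v v∈ → ↾-intro {X} {L} (↾-⊆ X K v v∈) (to (sat-□-info K (info L) {w}) below v v∈)) ,
      let v , v∈ , ¬i , i = to (sat-◇ (~ info K & info L) {w}) beyond
      in v , ↾-intro {X} {L} v∈ i , λ v∈K → ¬i (proj₂ (↾-elim {X} {K} v∈K)))
    (λ (K⊆L , v , v∈L , v∉K) →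
      from (sat-□-info K (info L) {w}) (λ u u∈ → proj₂ (↾-elim {X} {L} (K⊆L u u∈))) ,
      let v∈X , i = ↾-elim {X} {L} v∈L
      in from (sat-◇ (~ info K & info L) {w}) (v , v∈X , (λ iK → v∉K (↾-intro {X} {K} v∈X iK)) , i))

  MaxType : DNF → List Disj → State → Set
  MaxType Θ K X = Good K (X ↾ K) × (∀ L → L ∈L subs Θ → X ↾ K ⊂ X ↾ L → ¬ Good L (X ↾ L))

  sat-maxK : ∀ Θ K → NMDNF Θ → NMDNF K → ∀ {w X} → sat (maxK Θ K) w X ⇔ MaxType Θ K X
  sat-maxK Θ K hΘ hK {w} {X} = mk⇔
    (λ (g , rest) → to (sat-good K hK) g , λ L L∈ K⊂L gL →
      to (sat-⊃ (strictlyBelow K L) (~ good L)) (to (sat-⋀-map clause (subs Θ)) rest L L∈)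
         (from (sat-strictlyBelow K L {w}) K⊂L) (from (sat-good L (hL L∈) {w}) gL))
    (λ (g , maximal) → from (sat-good K hK) g , from (sat-⋀-map clause (subs Θ)) λ L L∈ →
      from (sat-⊃ (strictlyBelow K L) (~ good L)) λ K⊂L gL →
        maximal L L∈ (to (sat-strictlyBelow K L {w}) K⊂L) (to (sat-good L (hL L∈) {w}) gL))
    where
    clause : List Disj → Fm
    clause L = strictlyBelow K L ⊃ ~ good L
    hL : ∀ {L} → L ∈L subs Θ → NMDNF L
    hL L∈ = NMDNF-⊑ (subs-⊑ Θ L∈) hΘ

  sat-state : ∀ ST {v X} → sat (state ST) v X ⇔
    ((∀ s → s ∈L proj₁ ST → sat (nm s) v X) × (∀ s → s ∈L proj₂ ST → ¬ sat (nm s) v X))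
  sat-state (T , F) = mk⇔
    (λ (pos , neg) → to (sat-⋀-map nm T) pos , to (sat-⋀-map (λ s → ~ nm s) F) neg)
    (λ (pos , neg) → from (sat-⋀-map nm T) pos , from (sat-⋀-map (λ s → ~ nm s) F) neg)

  sat-witness : ∀ K s → NMDisj s → ∀ {v X} → sat (witness K s) v X ⇔ Fits s (X ↾ K)
  sat-witness K s (_ , nm-bx , nm-dias) {v} {X} = mk⇔
    (λ (□bx , ◇dias) →
      (λ u u∈ → local (bx s) nm-bx (to (sat-□-info K (bx s) {v}) □bx u u∈)) ,
      λ γ γ∈ → let u , u∈ , c = to (sat-◇-info K γ {v}) (to (sat-⋀-map ◇info (dias s)) ◇dias γ γ∈)
               in u , u∈ , local γ (nm-dias γ γ∈) c)
    (λ (bxs , wit) →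
      from (sat-□-info K (bx s) {v}) (λ u u∈ → local (bx s) nm-bx (bxs u u∈)) ,
      from (sat-⋀-map ◇info (dias s)) λ γ γ∈ →
        let u , u∈ , c = wit γ γ∈ in from (sat-◇-info K γ {v}) (u , u∈ , local γ (nm-dias γ γ∈) c))
    where
    ◇info : Fm → Fm
    ◇info γ = ◇ (info K & γ)

  -- The consequent of the K-clause says that Ω holds throughout X ↾ K:
  -- quantifying over the "states" (which disjuncts of Ω have true nonmodal
  -- part) is a case distinction on the truth of these nonmodal parts.
  sat-consequent : ∀ Ω K → NMDNF Ω → ∀ {w X} → sat (consequent Ω K) w X ⇔ Supported (SatN Ω) (X ↾ K)
  sat-consequent Ω K hΩ {w} {X} = mk⇔
    (λ s v v∈ → let x , x∈ , nm-x , fits = to (cases v) (to (sat-□-info K cases-fm {w}) s v v∈)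
                in x , x∈ , local (nm x) (proj₁ (hΩ x x∈)) nm-x , fits)
    (λ sup → from (sat-□-info K cases-fm {w}) λ v v∈ →
      let x , x∈ , nm-x , fits = sup v v∈
      in from (cases v) (x , x∈ , local (nm x) (proj₁ (hΩ x x∈)) nm-x , fits))
    where
    case-fm : List Disj × List Disj → Fm
    case-fm ST = state ST ⊃ ⋁ (map (witness K) (proj₁ ST))
    cases-fm : Fm
    cases-fm = ⋀ (map case-fm (splits Ω))
    cases : ∀ v → sat cases-fm v X ⇔ (∃ λ x → x ∈L Ω × sat (nm x) v X × Fits x (X ↾ K))
    cases v = mk⇔
      (λ s → to (splits-cases (λ x → em {sat (nm x) v X}) Ω) λ ST ST∈ pos neg →
        let x , x∈ , q = to (sat-⋁-map (witness K) (proj₁ ST))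
                           (to (sat-⊃ (state ST) _) (to (sat-⋀-map case-fm (splits Ω)) s ST ST∈)
                               (from (sat-state ST) (pos , neg)))
        in x , x∈ , to (sat-witness K x (hΩ x (splits-⊑₁ Ω ST∈ x∈))) q)
      (λ ex → from (sat-⋀-map case-fm (splits Ω)) λ ST ST∈ → from (sat-⊃ (state ST) _) λ st →
        let x , x∈ , fits = from (splits-cases (λ x → em {sat (nm x) v X}) Ω) ex ST ST∈
                              (proj₁ (to (sat-state ST) st)) (proj₂ (to (sat-state ST) st))
        in from (sat-⋁-map (witness K) (proj₁ ST))
             (x , x∈ , from (sat-witness K x (hΩ x (splits-⊑₁ Ω ST∈ x∈))) fits))

  sat-star : ∀ Θ Ω → NMDNF Θ → NMDNF Ω → ∀ {w X} → sat (star Θ Ω) w X ⇔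
    (∀ K → K ∈L subs Θ → MaxType Θ K X → Supported (SatN Ω) (X ↾ K))
  sat-star Θ Ω hΘ hΩ {w} {X} = mk⇔
    (λ s K K∈ max → to (sat-consequent Ω K hΩ {w})
       (to (sat-⊃ (maxK Θ K) (consequent Ω K)) (to (sat-⋀-map clause (subs Θ)) s K K∈)
           (from (sat-maxK Θ K hΘ (hK K∈) {w}) max)))
    (λ h → from (sat-⋀-map clause (subs Θ)) λ K K∈ → from (sat-⊃ (maxK Θ K) (consequent Ω K)) λ m →
       from (sat-consequent Ω K hΩ {w}) (h K K∈ (to (sat-maxK Θ K hΘ (hK K∈) {w}) m)))
    where
    clause : List Disj → Fm
    clause K = maxK Θ K ⊃ consequent Ω K
    hK : ∀ {K} → K ∈L subs Θ → NMDNF K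
    hK K∈ = NMDNF-⊑ (subs-⊑ Θ K∈) hΘ

  restriction-supported : ∀ Θ K {X} → K ⊑ Θ → NMDNF K → Good K (X ↾ K) → Supported (SatN Θ) (X ↾ K)
  restriction-supported Θ K {X} K⊑Θ hK =
    info-supported Θ K K⊑Θ λ u u∈ → local (info K) (info-NM K hK) (proj₂ (↾-elim {X} {K} u∈))

  within-fitting : ∀ Θ → NMDNF Θ → ∀ {X Y} → Y ⊆ X → Supported (SatN Θ) Y → Y ⊆ X ↾ fitting Θ Y
  within-fitting Θ hΘ {X} {Y} Y⊆X sup v v∈ =
    ↾-intro {X} {K} (Y⊆X v v∈)
      (local (info K) (info-NM K (NMDNF-⊑ (fitting-⊑ Θ Y) hΘ)) (fitting-info Θ sup v∈))
    where K = fitting Θ Y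

  fitting-good : ∀ Θ → NMDNF Θ → ∀ {X Y} → Y ⊆ X → Supported (SatN Θ) Y →
    Good (fitting Θ Y) (X ↾ fitting Θ Y)
  fitting-good Θ hΘ {X} {Y} Y⊆X sup =
    Witnessed-mono (concatMap dias K) (dias-NM K (NMDNF-⊑ (fitting-⊑ Θ Y) hΘ))
      (within-fitting Θ hΘ Y⊆X sup) (fitting-witnessed Θ Y)
    where K = fitting Θ Y

  maximal⇒MaxType : ∀ Θ → NMDNF Θ → ∀ {X X′} → MaxSupported (SatN Θ) X X′ →
    MaxType Θ (fitting Θ X′) X × X′ ⊆ X ↾ fitting Θ X′ × X ↾ fitting Θ X′ ⊆ X′
  maximal⇒MaxType Θ hΘ {X} {X′} (X′⊆X , sup , maximal) = (good-K , none-above) , X′⊆XK , XK⊆X′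
    where
    K = fitting Θ X′
    X′⊆XK = within-fitting Θ hΘ X′⊆X sup
    good-K = fitting-good Θ hΘ X′⊆X sup
    XK⊆X′ = maximal (X ↾ K) X′⊆XK (↾-⊆ X K)
              (restriction-supported Θ K (fitting-⊑ Θ X′) (NMDNF-⊑ (fitting-⊑ Θ X′) hΘ) good-K)
    none-above : ∀ L → L ∈L subs Θ → X ↾ K ⊂ X ↾ L → ¬ Good L (X ↾ L)
    none-above L L∈ (K⊆L , v , v∈L , v∉K) good-L = v∉K (X′⊆XK v (XL⊆X′ v v∈L))
      where
      XL⊆X′ = maximal (X ↾ L) (λ u u∈ → K⊆L u (X′⊆XK u u∈)) (↾-⊆ X L)
                (restriction-supported Θ L (subs-⊑ Θ L∈) (NMDNF-⊑ (subs-⊑ Θ L∈) hΘ) good-L)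

  MaxType⇒maximal : ∀ Θ K → NMDNF Θ → K ∈L subs Θ → ∀ {X} → MaxType Θ K X →
    MaxSupported (SatN Θ) X (X ↾ K)
  MaxType⇒maximal Θ K hΘ K∈ {X} (good-K , none-above) =
    ↾-⊆ X K , restriction-supported Θ K (subs-⊑ Θ K∈) (NMDNF-⊑ (subs-⊑ Θ K∈) hΘ) good-K , maximal
    where
    maximal : ∀ Y → X ↾ K ⊆ Y → Y ⊆ X → Supported (SatN Θ) Y → Y ⊆ X ↾ K
    maximal Y XK⊆Y Y⊆X sup u u∈ with em {u ∈ X ↾ K}
    ... | yes u∈K = u∈K
    ... | no u∉K  = ⊥-elim (none-above L (filter∈subs (λ d → em {Fits d Y}) Θ)
                      ((λ v v∈ → Y⊆XL v (XK⊆Y v v∈)) , u , Y⊆XL u u∈ , u∉K)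
                      (fitting-good Θ hΘ Y⊆X sup))
      where
      L = fitting Θ Y
      Y⊆XL = within-fitting Θ hΘ Y⊆X sup

  SatN-≐ : ∀ D → NMDNF D → ∀ {v Y Z} → Y ⊆ Z → Z ⊆ Y → SatN D v Y → SatN D v Z
  SatN-≐ D hD Y⊆Z Z⊆Y (d , d∈ , nm-d , bxs , wit) =
    d , d∈ , local (nm d) nm-nm nm-d ,
    (λ u u∈ → local (bx d) nm-bx (bxs u (Z⊆Y u u∈))) ,
    Witnessed-mono (dias d) nm-dias Y⊆Z wit
    where
    nm-nm = proj₁ (hD d d∈) ; nm-bx = proj₁ (proj₂ (hD d d∈)) ; nm-dias = proj₂ (proj₂ (hD d d∈))

  star-correct : ∀ Θ Ω → NMDNF Θ → NMDNF Ω → ∀ {w X} →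
    KMConditional (SatN Θ) (SatN Ω) X ⇔ sat (star Θ Ω) w X
  star-correct Θ Ω hΘ hΩ {w} {X} = mk⇔
    (λ km → from (sat-star Θ Ω hΘ hΩ {w}) λ K K∈ maxType →
       km (X ↾ K) (MaxType⇒maximal Θ K hΘ K∈ maxType))
    (λ s X′ maxX′ v v∈ →
       let maxType , X′⊆XK , XK⊆X′ = maximal⇒MaxType Θ hΘ maxX′
           K∈ = filter∈subs (λ d → em {Fits d X′}) Θ
           sup = to (sat-star Θ Ω hΘ hΩ {w}) s (fitting Θ X′) K∈ maxType
       in SatN-≐ Ω hΩ XK⊆X′ X′⊆XK (sup v (X′⊆XK v v∈)))

  †-correct : ∀ δ {w X} → sat δ w X ⇔ sat (δ †) w X
  †-correct (at n) {w} {X} = ⇔-id (sat (at n) w X)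
  †-correct (~ δ) = mk⇔
    (λ ¬s s† → ¬s (from (†-correct δ) s†))
    (λ ¬s† s → ¬s† (to (†-correct δ) s))
  †-correct (δ & ε) = mk⇔
    (λ (a , b) → to (†-correct δ) a , to (†-correct ε) b)
    (λ (a , b) → from (†-correct δ) a , from (†-correct ε) b)
  †-correct (□ δ) = mk⇔
    (λ s v v∈ → to (†-correct δ) (s v v∈))
    (λ s v v∈ → from (†-correct δ) (s v v∈))
  -- Sat (φ ⇒ ψ) is KMConditional (Sat φ) (Sat ψ); replace φ and ψ by the
  -- normal forms of their translations and apply star-correct.
  †-correct (φ ⇒ ψ) =
    star-correct (NF (φ †)) (NF (ψ †)) (nf-NM true (φ †)) (nf-NM true (ψ †))
    ⇔-∘ KMConditional-cong
          (λ v Y → nf-correct (φ †) (†-⇒free φ) ⇔-∘ †-correct φ)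
          (λ v Y → nf-correct (ψ †) (†-⇒free ψ) ⇔-∘ †-correct ψ)

theorem2 : (δ : Fm) →
    IsL (δ †) ×
    (ExcludedMiddle 0ℓ →
      (M : Model) (w : W M) (X : W M → Bool) →
      Sat M δ w X ⇔ Sat M (δ †) w X)
theorem2 δ = †-⇒free δ , λ em M w X → Classical.†-correct em M δ
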